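{- Let $\alpha\in\mathrm{Comp}(n,s)$ with $\alpha_i\ge\lambda_i$ for all $i$, let $(i,j)$ be a free pair for $\alpha$, and let $t\in\mathbb{F}$. Then the matrices (with respect to the basis $f_1,\dots,f_K$) of $U_{i,j}(t)$ and $\widehat U_{i,j}(t)$ are unipotent upper triangular.
   Context: Setup: $\mathbb{F}$ a field, $n\ge0$, $\lambda$ a partition of $k\le n$, $s\ge\ell(\lambda)$, $\lambda_i=0$ for $i>\ell(\lambda)$, $\Lambda=(\lambda_1+n-k,\dots,\lambda_s+n-k)$, $K=k+(n-k)s$. $[\Lambda]=\{(i,j):1\le i\le s,1\le j\le\Lambda_i\}$ (row $i$ from the top, column $j$ from the left), $[\lambda]=\{(i,j):1\le j\le\lambda_i\}$. $T:[\Lambda]\to\{1,\dots,K\}$ is the reverse reading order filling: $T(i,j)=\ell$ iff $(i,j)$ is the $\ell$th cell when reading down each column (top to bottom), columns taken from left to right; $T(c)$ is the label of $c$. With $f_1,\dots,f_K$ the standard basis of $\mathbb{F}^K$: $Nf_{T(i,j)}=f_{T(i,j+1)}$ if $j<\Lambda_i$, $Nf_{T(i,\Lambda_i)}=0$; $N^tf_{T(i,j)}=f_{T(i,j-1)}$ if $j>1$, $N^tf_{T(i,1)}=0$. $\mathrm{Comp}(n,s)$ is the set of $s$-tuples of nonnegative integers summing to $n$; $[\alpha]=\{(i,j):1\le j\le\alpha_i\}$. A free pair for $\alpha$ is a pair of labels $(i,j)$ with $i>j$ such that the cell labeled $i$ lies in $[\alpha]\setminus[\lambda]$ and the cell labeled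 $j$ is the leftmost cell of $[\Lambda]\setminus[\alpha]$ in its row. For a free pair $(i,j)$ and $t\in\mathbb{F}$, $U_{i,j}(t)$ is the linear map with $U_{i,j}(t)(N^mf_i)=N^m(f_i+tf_j)$ and $U_{i,j}(t)((N^t)^mf_i)=(N^t)^m(f_i+tf_j)$ for all $m\ge0$, and $U_{i,j}(t)f_\ell=f_\ell$ for every label $\ell$ not in the row of $i$. $\widehat U_{i,j}(t)$ is the linear map with $\widehat U_{i,j}(t)(N^mf_i)=N^m(f_i+tf_j)$ for all $m\ge0$ and $\widehat U_{i,j}(t)f_\ell=f_\ell$ for every label $\ell$ that is either not in the row of $i$ or not weakly to the right of the cell of $i$. -}

module Defs where

open import Level using (Level; _⊔_)
open import Algebra.Bundles using (CommutativeRing)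
open import Data.Nat using (ℕ; zero; suc; _∸_; _≤_; _<_; _≤?_; _<?_; _≡ᵇ_; _<ᵇ_)
import Data.Nat as ℕ
open import Data.Fin using (Fin; toℕ)
import Data.Fin as F
open import Data.List using (List; []; _∷_; map; concatMap; upTo; allFin; length; filter)
open import Data.Product using (Σ; ∃; _×_; _,_)
open import Data.Sum using (_⊎_)
open import Data.Maybe using (Maybe; just; nothing)
open import Data.Bool using (if_then_else_)
open import Function using (_∘_)
open import Relation.Nullary using (¬_; Dec; yes; no)
open import Relation.Nullary.Decidable using (_⊎-dec_; _×-dec_)
open import Relation.Binary.PropositionalEquality using (_≡_)

IsField : ∀ {c ℓ} → CommutativeRing c ℓ → Set (c ⊔ ℓ)
IsField R = ¬ (1# ≈ 0#) × (∀ x → ¬ (x ≈ 0#) → ∃ λ y → x * y ≈ 1#)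
  where open CommutativeRing R

sumFin : (s : ℕ) → (Fin s → ℕ) → ℕ
sumFin zero    f = 0
sumFin (suc s) f = f F.zero ℕ.+ sumFin s (f ∘ F.suc)

-- A cell (row, column); rows are Fin s (top row = 0), columns are 1-based.
Cell : ℕ → Set
Cell s = Fin s × ℕ

InDiagram : {s : ℕ} → (Fin s → ℕ) → Cell s → Set
InDiagram μ (r , c) = 1 ≤ c × c ≤ μ r

bigΛ : {s : ℕ} → ℕ → ℕ → (Fin s → ℕ) → Fin s → ℕ
bigΛ n k lam r = lam r ℕ.+ (n ∸ k)

module Tableau (s : ℕ) (Λ : Fin s → ℕ) where

  cells : List (Cell s)
  cells = concatMap (λ r → map (λ c → r , suc c) (upTo (Λ r))) (allFin s)

  _≺_ : Cell s → Cell s → Set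
  (r' , c') ≺ (r , c) = c' < c ⊎ (c' ≡ c × toℕ r' < toℕ r)

  _≺?_ : (d e : Cell s) → Dec (d ≺ e)
  (r' , c') ≺? (r , c) = (c' <? c) ⊎-dec ((c' ℕ.≟ c) ×-dec (toℕ r' <? toℕ r))

  -- T(d): d is the T(d)-th cell of [Λ] in reading order
  label : Cell s → ℕ
  label d = suc (length (filter (λ e → e ≺? d) cells))

  cellOf : ℕ → Maybe (Cell s)
  cellOf ℓ = go cells
    where
    go : List (Cell s) → Maybe (Cell s)
    go []       = nothing
    go (d ∷ ds) with label d ℕ.≟ ℓ
    ... | yes _ = just d
    ... | no  _ = go ds

FreePair : (s : ℕ) (lam α : Fin s → ℕ) (n k i j : ℕ) → Set
FreePair s lam α n k i j =
  j < i
  × (Σ (Cell s) λ d → InDiagram (bigΛ n k lam) d × Tableau.label s (bigΛ n k lam) d ≡ i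
       × InDiagram α d × ¬ InDiagram lam d)
  × (Σ (Fin s) λ r → suc (α r) ≤ bigΛ n k lam r
       × Tableau.label s (bigΛ n k lam) (r , suc (α r)) ≡ j)

module Maps {c ℓ} (R : CommutativeRing c ℓ) (s : ℕ) (Λ : Fin s → ℕ) where
  open CommutativeRing R
  open Tableau s Λ

  -- vectors of 𝔽^K, indexed by labels (coordinate a = coefficient of f_a)
  V : Set c
  V = ℕ → Carrier

  f : ℕ → V
  f ℓ' a = if a ≡ᵇ ℓ' then 1# else 0#

  _⊕_ : V → V → V
  (v ⊕ w) a = v a + w a

  _⊛_ : Carrier → V → V
  (x ⊛ v) a = x * v a

  -- N f_{T(r,c)} = f_{T(r,c+1)} (or 0 at the end of the row), extended linearly
  N : V → V
  N v a with cellOf a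
  ... | just (r , suc (suc c)) = v (label (r , suc c))
  ... | _ = 0#

  -- Nᵗ f_{T(r,c)} = f_{T(r,c-1)} (or 0 at the start of the row), extended linearly
  Nt : V → V
  Nt v a with cellOf a
  ... | just (r , c) = if c <ᵇ Λ r then v (label (r , suc c)) else 0#
  ... | nothing = 0#

  iter : ℕ → (V → V) → V → V
  iter zero    g v = v
  iter (suc m) g v = g (iter m g v)

  -- images of the basis vector f_{T(d)} under U_{i,j}(t) and Û_{i,j}(t)
  Uimg : ℕ → ℕ → Carrier → Cell s → V
  Uimg i j t (r , c) with cellOf i
  ... | nothing = f (label (r , c))
  ... | just (ri , ci) with r F.≟ ri | ci ≤? c
  ...   | yes _ | yes _ = iter (c ∸ ci) N (f i ⊕ (t ⊛ f j))
  ...   | yes _ | no  _ = iter (ci ∸ c) Nt (f i ⊕ (t ⊛ f j))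
  ...   | no  _ | _     = f (label (r , c))

  Uhatimg : ℕ → ℕ → Carrier → Cell s → V
  Uhatimg i j t (r , c) with cellOf i
  ... | nothing = f (label (r , c))
  ... | just (ri , ci) with r F.≟ ri | ci ≤? c
  ...   | yes _ | yes _ = iter (c ∸ ci) N (f i ⊕ (t ⊛ f j))
  ...   | _     | _     = f (label (r , c))

  -- matrix w.r.t. f_1,…,f_K : entry (x , y) = coefficient of f_{x+1} in the image of f_{y+1}
  matrixOf : (K : ℕ) → (Cell s → V) → Fin K → Fin K → Carrier
  matrixOf K img x y with cellOf (suc (toℕ y))
  ... | just d  = img d (suc (toℕ x))
  ... | nothing = 0#

  Umat : (K i j : ℕ) → Carrier → Fin K → Fin K → Carrier
  Umat K i j t = matrixOf K (Uimg i j t)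

  Uhatmat : (K i j : ℕ) → Carrier → Fin K → Fin K → Carrier
  Uhatmat K i j t = matrixOf K (Uhatimg i j t)

UnipotentUpperTriangular : ∀ {c ℓ} (R : CommutativeRing c ℓ) (K : ℕ)
  → (Fin K → Fin K → CommutativeRing.Carrier R) → Set ℓ
UnipotentUpperTriangular R K M =
  (∀ x → M x x ≈ 1#) × (∀ x y → toℕ y < toℕ x → M x y ≈ 0#)
  where open CommutativeRing R

{-# OPTIONS --safe #-}
-- Identify the basis with the cells of [Λ] via T; then K = |[Λ]|, and reading-order labels are
-- strictly monotone. Call a vector a unipotent column at a cell d if its f_{T(d)}-coefficient is 1
-- and all later coefficients vanish. Shifting two cells one column to the right or left does not
-- change their relative reading order, so N (resp. Nᵗ) maps a unipotent column at (r, c) to one at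
-- (r, c + 1) (resp. at (r, c - 1)). The image of each basis vector under U_{i,j}(t) or Û_{i,j}(t) is
-- either itself, or N^m or (Nᵗ)^m applied to f_i + t f_j, which is a unipotent column at the cell of
-- i because j < i; so every column of both matrices has the required shape.
module Submission where

open import Defs
open import Algebra.Bundles using (CommutativeRing)
open import Data.Nat using (ℕ; _+_; _*_; _∸_; _≤_)
open import Data.Fin using (Fin)
import Data.Fin as F
open import Data.Product using (_×_)
open import Relation.Binary.PropositionalEquality using (_≡_)

open import Data.Nat using (zero; suc; _<_; _≤?_; _≟_; _<ᵇ_; _≡ᵇ_; z≤n; s≤s; s≤s⁻¹)
open import Data.Nat.Properties
import Algebra.Properties.CommutativeSemigroup as CommutativeSemigroupProperties
open import Data.Bool using (true; false)
open import Data.Bool.Properties using (T-≡)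
open import Function.Bundles using (Equivalence)
open import Data.Fin using (toℕ)
import Data.Fin.Properties as Fin
open import Data.List using (List; []; _∷_; _++_; map; concatMap; upTo; allFin; tabulate; length; filter)
open import Data.List.Properties using (length-++; length-map; length-upTo; length-filter; filter-accept; filter-reject)
open import Data.List.Membership.Propositional using (_∈_)
open import Data.List.Membership.Propositional.Properties
  using (∈-concatMap⁺; ∈-concatMap⁻; ∈-map⁺; ∈-map⁻; ∈-upTo⁺; ∈-upTo⁻; ∈-allFin)
open import Data.List.Relation.Unary.Any as Any using (here; there)
import Data.List.Relation.Unary.All as All
import Data.List.Relation.Unary.All.Properties as All
open import Data.List.Relation.Unary.AllPairs as AllPairs using (_∷_)
import Data.List.Relation.Unary.AllPairs.Properties as AllPairs
open import Data.List.Relation.Unary.Unique.Propositional using (Unique)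
import Data.List.Relation.Unary.Unique.Propositional.Properties as Unique
open import Data.List.Relation.Binary.Disjoint.Propositional using (Disjoint)
open import Data.Maybe using (Maybe; just; nothing)
open import Data.Product using (∃-syntax; _,_; proj₁; proj₂)
open import Data.Sum using (_⊎_; inj₁; inj₂)
open import Relation.Nullary using (¬_; yes; no; contradiction)
open import Level using (0ℓ)
open import Relation.Binary.Core using (Rel)
open import Relation.Binary.Definitions using (Transitive; Trichotomous; Decidable; tri<; tri≈; tri>)
open import Relation.Binary.Consequences using (tri⇒irr)
open import Relation.Binary.PropositionalEquality using (_≢_; ≢-sym; refl; sym; trans; cong; cong₂; subst; module ≡-Reasoning)
open import Function using (id; _∘_)

module Rank {A : Set} {_≺_ : Rel A 0ℓ} (≺-trans : Transitive _≺_)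
  (compare : Trichotomous _≡_ _≺_) (_≺?_ : Decidable _≺_) where

  rank : List A → A → ℕ
  rank xs d = length (filter (_≺? d) xs)

  rank-∷-≺ : ∀ {x xs d} → x ≺ d → rank (x ∷ xs) d ≡ suc (rank xs d)
  rank-∷-≺ {d = d} x≺d = cong length (filter-accept (_≺? d) x≺d)

  rank-∷-⊀ : ∀ {x xs d} → ¬ x ≺ d → rank (x ∷ xs) d ≡ rank xs d
  rank-∷-⊀ {d = d} x⊀d = cong length (filter-reject (_≺? d) x⊀d)

  rank-mono : ∀ xs {d e} → (∀ {x} → x ≺ d → x ≺ e) → rank xs d ≤ rank xs e
  rank-mono []       _   = z≤n
  rank-mono (x ∷ xs) {d} {e} d⊆e with x ≺? d | x ≺? e
  ... | yes _   | yes _   = s≤s (rank-mono xs d⊆e)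
  ... | yes x≺d | no  x⊀e = contradiction (d⊆e x≺d) x⊀e
  ... | no  _   | yes _   = m≤n⇒m≤1+n (rank-mono xs d⊆e)
  ... | no  _   | no  _   = rank-mono xs d⊆e

  rank-strict : ∀ {xs d e} → d ∈ xs → d ≺ e → rank xs d < rank xs e
  rank-strict {x ∷ xs} {e = e} (here refl) x≺e = begin-strict
    rank (x ∷ xs) x ≡⟨ rank-∷-⊀ (tri⇒irr compare refl) ⟩
    rank xs x       ≤⟨ rank-mono xs (λ y≺x → ≺-trans y≺x x≺e) ⟩
    rank xs e       <⟨ n<1+n _ ⟩
    suc (rank xs e) ≡⟨ rank-∷-≺ x≺e ⟨
    rank (x ∷ xs) e ∎
    where open ≤-Reasoning
  rank-strict {x ∷ xs} {d} {e} (there d∈xs) d≺e with x ≺? d | x ≺? e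
  ... | yes _   | yes _   = s≤s (rank-strict d∈xs d≺e)
  ... | yes x≺d | no  x⊀e = contradiction (≺-trans x≺d d≺e) x⊀e
  ... | no  _   | yes _   = m<n⇒m<1+n (rank-strict d∈xs d≺e)
  ... | no  _   | no  _   = rank-strict d∈xs d≺e

  rank-surjective : ∀ xs → Unique xs → ∀ {a} → a < length xs → ∃[ d ] d ∈ xs × rank xs d ≡ a
  rank-surjective (x ∷ xs) (x≢xs ∷ xs!) {a} a<len with <-cmp a (rank xs x)
  ... | tri≈ _ refl _ = x , here refl , rank-∷-⊀ (tri⇒irr compare refl)
  ... | tri< a<rx _ _
    with y , y∈xs , ry ← rank-surjective xs xs! (<-≤-trans a<rx (length-filter (_≺? x) xs)) =
    y , there y∈xs , trans (rank-∷-⊀ x⊀y) ry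
    where
    x⊀y : ¬ x ≺ y
    x⊀y x≺y = <⇒≱ a<rx (subst (_ ≤_) ry (rank-mono xs (λ z≺x → ≺-trans z≺x x≺y)))
  rank-surjective (x ∷ xs) (x≢xs ∷ xs!) {suc a} (s≤s a<len) | tri> _ _ rx≤a
    with y , y∈xs , ry ← rank-surjective xs xs! a<len =
    y , there y∈xs , trans (rank-∷-≺ x≺y) (cong suc ry)
    where
    x≺y : x ≺ y
    x≺y with compare x y
    ... | tri< x≺y _ _ = x≺y
    ... | tri≈ _ refl _ = contradiction refl (All.lookup x≢xs y∈xs)
    ... | tri> _ _ y≺x = contradiction (subst (_< rank xs x) ry (rank-strict y∈xs y≺x)) (≤⇒≯ (s≤s⁻¹ rx≤a))

module ReadingOrder (s : ℕ) (Λ : Fin s → ℕ) where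
  open Tableau s Λ

  ≺-trans : Transitive _≺_
  ≺-trans (inj₁ c<c′)          (inj₁ c′<c″)          = inj₁ (<-trans c<c′ c′<c″)
  ≺-trans (inj₁ c<c′)          (inj₂ (refl , _))     = inj₁ c<c′
  ≺-trans (inj₂ (refl , _))    (inj₁ c′<c″)          = inj₁ c′<c″
  ≺-trans (inj₂ (refl , r<r′)) (inj₂ (refl , r′<r″)) = inj₂ (refl , <-trans r<r′ r′<r″)

  ≺-irrefl : ∀ {d} → ¬ d ≺ d
  ≺-irrefl (inj₁ c<c)       = <-irrefl refl c<c
  ≺-irrefl (inj₂ (_ , r<r)) = <-irrefl refl r<r

  ≡-or-≺-or-≻ : ∀ d e → d ≡ e ⊎ d ≺ e ⊎ e ≺ d
  ≡-or-≺-or-≻ (r , c) (r′ , c′) with <-cmp c c′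
  ... | tri< c<c′ _ _ = inj₂ (inj₁ (inj₁ c<c′))
  ... | tri> _ _ c>c′ = inj₂ (inj₂ (inj₁ c>c′))
  ... | tri≈ _ refl _ with Fin.<-cmp r r′
  ...   | tri< r<r′ _ _ = inj₂ (inj₁ (inj₂ (refl , r<r′)))
  ...   | tri≈ _ refl _ = inj₁ refl
  ...   | tri> _ _ r>r′ = inj₂ (inj₂ (inj₂ (refl , r>r′)))

  ≺-compare : Trichotomous _≡_ _≺_
  ≺-compare d e with ≡-or-≺-or-≻ d e
  ... | inj₁ refl       = tri≈ ≺-irrefl refl ≺-irrefl
  ... | inj₂ (inj₁ d≺e) = tri< d≺e (λ { refl → ≺-irrefl d≺e }) (λ e≺d → ≺-irrefl (≺-trans d≺e e≺d))
  ... | inj₂ (inj₂ e≺d) = tri> (λ d≺e → ≺-irrefl (≺-trans d≺e e≺d)) (λ { refl → ≺-irrefl e≺d }) e≺d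

  ≺-suc : ∀ {r c r′ c′} → (r , c) ≺ (r′ , c′) → (r , suc c) ≺ (r′ , suc c′)
  ≺-suc (inj₁ c<c′)          = inj₁ (s≤s c<c′)
  ≺-suc (inj₂ (refl , r<r′)) = inj₂ (refl , r<r′)

  ≺-suc⁻¹ : ∀ {r c r′ c′} → (r , suc c) ≺ (r′ , suc c′) → (r , c) ≺ (r′ , c′)
  ≺-suc⁻¹ (inj₁ c<c′)          = inj₁ (s≤s⁻¹ c<c′)
  ≺-suc⁻¹ (inj₂ (refl , r<r′)) = inj₂ (refl , r<r′)

  row : Fin s → List (Cell s)
  row r = map (λ c → r , suc c) (upTo (Λ r))

  ∈-cells⇒InDiagram : ∀ {d} → d ∈ cells → InDiagram Λ d
  ∈-cells⇒InDiagram d∈ with r , d∈row ← Any.satisfied (∈-concatMap⁻ row {xs = allFin s} d∈)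
                         with c , c∈ , refl ← ∈-map⁻ (λ c → r , suc c) d∈row
    = s≤s z≤n , ∈-upTo⁻ c∈

  InDiagram⇒∈-cells : ∀ {d} → InDiagram Λ d → d ∈ cells
  InDiagram⇒∈-cells {r , suc c} (_ , c<Λr) =
    ∈-concatMap⁺ row {xs = allFin s} (Any.map (λ { refl → ∈-map⁺ (λ c → r , suc c) (∈-upTo⁺ c<Λr) }) (∈-allFin r))

  ∈-cells-convex : ∀ {r c c′ c″} → (r , c) ∈ cells → (r , c″) ∈ cells → c ≤ c′ → c′ ≤ c″ → (r , c′) ∈ cells
  ∈-cells-convex d∈ d″∈ c≤c′ c′≤c″ = InDiagram⇒∈-cells
    (≤-trans (proj₁ (∈-cells⇒InDiagram d∈)) c≤c′ , ≤-trans c′≤c″ (proj₂ (∈-cells⇒InDiagram d″∈)))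

  rows-disjoint : ∀ {r r′} → r ≢ r′ → Disjoint (row r) (row r′)
  rows-disjoint r≢r′ (d∈row , d∈row′)
    with _ , _ , refl ← ∈-map⁻ _ d∈row
    with _ , _ , refl ← ∈-map⁻ _ d∈row′ = r≢r′ refl

  cells-unique : Unique cells
  cells-unique = Unique.concat⁺
    (All.map⁺ (All.universal (λ r → Unique.map⁺ (λ { refl → refl }) (Unique.upTo⁺ (Λ r))) (allFin s)))
    (AllPairs.map⁺ (AllPairs.map rows-disjoint (Unique.allFin⁺ s)))

  length-concatMap-row : ∀ {m} (h : Fin m → Fin s) → length (concatMap row (tabulate h)) ≡ sumFin m (Λ ∘ h)
  length-concatMap-row {zero}  h = refl
  length-concatMap-row {suc m} h = begin
    length (row (h F.zero) ++ concatMap row (tabulate (h ∘ F.suc)))  ≡⟨ length-++ (row (h F.zero)) ⟩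
    length (row (h F.zero)) + length (concatMap row (tabulate (h ∘ F.suc)))
      ≡⟨ cong₂ _+_ (trans (length-map _ (upTo (Λ (h F.zero)))) (length-upTo (Λ (h F.zero)))) (length-concatMap-row (h ∘ F.suc)) ⟩
    Λ (h F.zero) + sumFin m (Λ ∘ h ∘ F.suc)  ∎
    where open ≡-Reasoning

  length-cells : length cells ≡ sumFin s Λ
  length-cells = length-concatMap-row id

  open Rank ≺-trans ≺-compare _≺?_

  label-mono : ∀ {d e} → d ∈ cells → d ≺ e → label d < label e
  label-mono d∈ d≺e = s≤s (rank-strict d∈ d≺e)

  label-<⇒≺ : ∀ {d e} → e ∈ cells → label d < label e → d ≺ e
  label-<⇒≺ {d} {e} e∈ ℓd<ℓe with ≺-compare d e
  ... | tri< d≺e _ _ = d≺e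
  ... | tri≈ _ refl _ = contradiction ℓd<ℓe (<-irrefl refl)
  ... | tri> _ _ e≺d = contradiction (label-mono e∈ e≺d) (<⇒≯ ℓd<ℓe)

  label-injective : ∀ {d e} → d ∈ cells → e ∈ cells → label d ≡ label e → d ≡ e
  label-injective {d} {e} d∈ e∈ ℓd≡ℓe with ≺-compare d e
  ... | tri< d≺e _ _ = contradiction ℓd≡ℓe (<⇒≢ (label-mono d∈ d≺e))
  ... | tri≈ _ d≡e _ = d≡e
  ... | tri> _ _ e≺d = contradiction ℓd≡ℓe (≢-sym (<⇒≢ (label-mono e∈ e≺d)))

  label-surjective : ∀ {a} → a < length cells → ∃[ d ] d ∈ cells × label d ≡ suc a
  label-surjective a<len with d , d∈ , rank≡a ← rank-surjective cells cells-unique a<len = d , d∈ , cong suc rank≡a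

  -- `cellOf ℓ` unfolds to `go ℓ cells` for a where-bound `go` of Defs that cannot be referred to;
  -- the with-abstraction over `cells` below lets unification name it `search`.
  mutual
    search : ℕ → List (Cell s) → Maybe (Cell s)
    search = _

    cellOf-search : ∀ ℓ → cellOf ℓ ≡ search ℓ cells
    cellOf-search ℓ with cells
    ... | xs = refl

  search-sound : ∀ {a d} xs → search a xs ≡ just d → d ∈ xs × label d ≡ a
  search-sound {a} (x ∷ xs) found with label x ≟ a
  search-sound     (x ∷ xs) refl  | yes ℓx≡a = here refl , ℓx≡a
  ... | no _ with d∈xs , ℓd≡a ← search-sound xs found = there d∈xs , ℓd≡a

  search-complete : ∀ {d} xs → d ∈ xs → (∀ {e} → e ∈ xs → label e ≡ label d → e ≡ d) → search (label d) xs ≡ just d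
  search-complete {d} (x ∷ xs) d∈ unique with label x ≟ label d
  ... | yes ℓx≡ℓd = cong just (unique (here refl) ℓx≡ℓd)
  search-complete (x ∷ xs) (here refl)  _      | no ℓx≢ℓd = contradiction refl ℓx≢ℓd
  search-complete (x ∷ xs) (there d∈xs) unique | no _     = search-complete xs d∈xs (unique ∘ there)

  cellOf-sound : ∀ {a d} → cellOf a ≡ just d → d ∈ cells × label d ≡ a
  cellOf-sound {a} found = search-sound cells (trans (sym (cellOf-search a)) found)

  cellOf-label : ∀ {d} → d ∈ cells → cellOf (label d) ≡ just d
  cellOf-label {d} d∈ = trans (cellOf-search (label d))
    (search-complete cells d∈ (λ e∈ ℓe≡ℓd → label-injective e∈ d∈ ℓe≡ℓd))

module Columns {c ℓ} (R : CommutativeRing c ℓ) (s : ℕ) (Λ : Fin s → ℕ) where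
  open Maps R s Λ
  open Tableau s Λ
  open ReadingOrder s Λ
  open CommutativeRing R using (Carrier; _≈_; 1#; 0#) renaming (_+_ to _+ᴿ_; _*_ to _*ᴿ_)
  module R = CommutativeRing R

  UnipotentColumn : Cell s → V → Set ℓ
  UnipotentColumn d w = w (label d) ≈ 1# × (∀ b → label d < b → w b ≈ 0#)

  f-diagonal : ∀ a → f a a ≡ 1#
  f-diagonal a with a ≡ᵇ a | ≡⇒≡ᵇ a a refl
  ... | true | _ = refl

  f-off-diagonal : ∀ {a b} → b ≢ a → f a b ≡ 0#
  f-off-diagonal {a} {b} b≢a with b ≡ᵇ a | ≡ᵇ⇒≡ b a
  ... | false | _   = refl
  ... | true  | b≡a = contradiction (b≡a _) b≢a

  f-unipotent : ∀ d → UnipotentColumn d (f (label d))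
  f-unipotent d = R.reflexive (f-diagonal (label d)) , λ b ℓd<b → R.reflexive (f-off-diagonal (>⇒≢ ℓd<b))

  +-*-zeroʳ : ∀ x t → x +ᴿ t *ᴿ 0# ≈ x
  +-*-zeroʳ x t = R.trans (R.+-congˡ (R.zeroʳ t)) (R.+-identityʳ x)

  f+tf-unipotent : ∀ {d i j} t → label d ≡ i → j < i → UnipotentColumn d (f i ⊕ (t ⊛ f j))
  f+tf-unipotent {i = i} {j} t refl j<i = diagonal , below
    where
    diagonal : f i i +ᴿ t *ᴿ f j i ≈ 1#
    diagonal rewrite f-diagonal i | f-off-diagonal (>⇒≢ j<i) = +-*-zeroʳ 1# t
    below : ∀ b → i < b → f i b +ᴿ t *ᴿ f j b ≈ 0#
    below b i<b rewrite f-off-diagonal (>⇒≢ i<b) | f-off-diagonal (>⇒≢ (<-trans j<i i<b)) = +-*-zeroʳ 0# t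

  N-unipotent : ∀ {r c v} → (r , c) ∈ cells → (r , suc c) ∈ cells
    → UnipotentColumn (r , c) v → UnipotentColumn (r , suc c) (N v)
  N-unipotent {c = zero} d∈ _ _ with () ← proj₁ (∈-cells⇒InDiagram d∈)
  N-unipotent {r} {suc c} {v} d∈ d′∈ (one , zeros) = diagonal , below
    where
    diagonal : N v (label (r , suc (suc c))) ≈ 1#
    diagonal rewrite cellOf-label d′∈ = one
    below : ∀ b → label (r , suc (suc c)) < b → N v b ≈ 0#
    below b ℓd′<b with cellOf b in found
    ... | nothing              = R.refl
    ... | just (r′ , zero)     = R.refl
    ... | just (r′ , suc zero) = R.refl
    ... | just (r′ , suc (suc c′)) with e∈ , refl ← cellOf-sound found =
      zeros _ (label-mono d∈ (≺-suc⁻¹ (label-<⇒≺ e∈ ℓd′<b)))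

  Nᵗ-unipotent : ∀ {r c v} → (r , c) ∈ cells → (r , suc c) ∈ cells
    → UnipotentColumn (r , suc c) v → UnipotentColumn (r , c) (Nt v)
  Nᵗ-unipotent {r} {c} {v} d∈ d′∈ (one , zeros) = diagonal , below
    where
    diagonal : Nt v (label (r , c)) ≈ 1#
    diagonal rewrite cellOf-label d∈ | Equivalence.to T-≡ (<⇒<ᵇ (proj₂ (∈-cells⇒InDiagram d′∈))) = one
    below : ∀ b → label (r , c) < b → Nt v b ≈ 0#
    below b ℓd<b with cellOf b in found
    ... | nothing = R.refl
    ... | just (r′ , c′) with c′ <ᵇ Λ r′
    ...   | false = R.refl
    ...   | true with e∈ , refl ← cellOf-sound found =
      zeros _ (label-mono d′∈ (≺-suc (label-<⇒≺ e∈ ℓd<b)))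

  iterate-N-unipotent : ∀ m {r c c′ v} → c + m ≡ c′ → (r , c) ∈ cells → (r , c′) ∈ cells
    → UnipotentColumn (r , c) v → UnipotentColumn (r , c′) (iter m N v)
  iterate-N-unipotent zero    {c = c} refl _ _ col rewrite +-identityʳ c = col
  iterate-N-unipotent (suc m) {r} {c} refl d∈ d′∈ col rewrite +-suc c m =
    N-unipotent mid∈ d′∈ (iterate-N-unipotent m refl d∈ mid∈ col)
    where
    mid∈ : (r , c + m) ∈ cells
    mid∈ = ∈-cells-convex d∈ d′∈ (m≤m+n c m) (n≤1+n (c + m))

  iterate-Nᵗ-unipotent : ∀ m {r c c′ v} → c + m ≡ c′ → (r , c) ∈ cells → (r , c′) ∈ cells
    → UnipotentColumn (r , c′) v → UnipotentColumn (r , c) (iter m Nt v)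
  iterate-Nᵗ-unipotent zero    {c = c} refl _ _ col rewrite +-identityʳ c = col
  iterate-Nᵗ-unipotent (suc m) {r} {c} refl d∈ d′∈ col =
    Nᵗ-unipotent d∈ next∈ (iterate-Nᵗ-unipotent m (sym (+-suc c m)) next∈ d′∈ col)
    where
    next∈ : (r , suc c) ∈ cells
    next∈ = ∈-cells-convex d∈ d′∈ (n≤1+n c) (m<m+n c (s≤s z≤n))

  module _ {i j : ℕ} (t : Carrier) (j<i : j < i) where

    Uimg-unipotent : ∀ d → d ∈ cells → UnipotentColumn d (Uimg i j t d)
    Uimg-unipotent (r , c) d∈ with cellOf i in found
    ... | nothing = f-unipotent (r , c)
    ... | just (rᵢ , cᵢ) with r F.≟ rᵢ | cᵢ ≤? c
    ...   | no _     | _        = f-unipotent (r , c)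
    ...   | yes refl | yes cᵢ≤c with dᵢ∈ , ℓdᵢ≡i ← cellOf-sound found =
      iterate-N-unipotent (c ∸ cᵢ) (m+[n∸m]≡n cᵢ≤c) dᵢ∈ d∈ (f+tf-unipotent t ℓdᵢ≡i j<i)
    ...   | yes refl | no cᵢ≰c  with dᵢ∈ , ℓdᵢ≡i ← cellOf-sound found =
      iterate-Nᵗ-unipotent (cᵢ ∸ c) (m+[n∸m]≡n (≰⇒≥ cᵢ≰c)) d∈ dᵢ∈ (f+tf-unipotent t ℓdᵢ≡i j<i)

    Uhatimg-unipotent : ∀ d → d ∈ cells → UnipotentColumn d (Uhatimg i j t d)
    Uhatimg-unipotent (r , c) d∈ with cellOf i in found
    ... | nothing = f-unipotent (r , c)
    ... | just (rᵢ , cᵢ) with r F.≟ rᵢ | cᵢ ≤? c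
    ...   | no _     | _        = f-unipotent (r , c)
    ...   | yes refl | no _     = f-unipotent (r , c)
    ...   | yes refl | yes cᵢ≤c with dᵢ∈ , ℓdᵢ≡i ← cellOf-sound found =
      iterate-N-unipotent (c ∸ cᵢ) (m+[n∸m]≡n cᵢ≤c) dᵢ∈ d∈ (f+tf-unipotent t ℓdᵢ≡i j<i)

  matrixOf-column : ∀ K img x y {d} → cellOf (suc (toℕ y)) ≡ just d → matrixOf K img x y ≡ img d (suc (toℕ x))
  matrixOf-column K img x y found rewrite found = refl

  matrixOf-unipotent : ∀ K (img : Cell s → V) → length cells ≡ K
    → (∀ d → d ∈ cells → UnipotentColumn d (img d)) → UnipotentUpperTriangular R K (matrixOf K img)
  matrixOf-unipotent K img len≡K columns = diagonal , below
    where
    column-cell : ∀ (y : Fin K) → ∃[ d ] d ∈ cells × label d ≡ suc (toℕ y)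
    column-cell y = label-surjective (subst (toℕ y <_) (sym len≡K) (Fin.toℕ<n y))
    diagonal : ∀ x → matrixOf K img x x ≈ 1#
    diagonal x with d , d∈ , ℓd≡ ← column-cell x
      rewrite matrixOf-column K img x x (trans (cong cellOf (sym ℓd≡)) (cellOf-label d∈)) | sym ℓd≡ =
      proj₁ (columns d d∈)
    below : ∀ x y → toℕ y < toℕ x → matrixOf K img x y ≈ 0#
    below x y y<x with d , d∈ , ℓd≡ ← column-cell y
      rewrite matrixOf-column K img x y (trans (cong cellOf (sym ℓd≡)) (cellOf-label d∈)) =
      proj₂ (columns d d∈) (suc (toℕ x)) (subst (_< suc (toℕ x)) (sym ℓd≡) (s≤s y<x))

sumFin-+ : ∀ s (g h : Fin s → ℕ) → sumFin s (λ r → g r + h r) ≡ sumFin s g + sumFin s h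
sumFin-+ zero    g h = refl
sumFin-+ (suc s) g h = begin
  (g F.zero + h F.zero) + sumFin s (λ r → g (F.suc r) + h (F.suc r))
    ≡⟨ cong ((g F.zero + h F.zero) +_) (sumFin-+ s (g ∘ F.suc) (h ∘ F.suc)) ⟩
  (g F.zero + h F.zero) + (sumFin s (g ∘ F.suc) + sumFin s (h ∘ F.suc))
    ≡⟨ +-interchange (g F.zero) (h F.zero) _ _ ⟩
  (g F.zero + sumFin s (g ∘ F.suc)) + (h F.zero + sumFin s (h ∘ F.suc)) ∎
  where
  open ≡-Reasoning
  open CommutativeSemigroupProperties +-commutativeSemigroup renaming (interchange to +-interchange)

sumFin-const : ∀ s a → sumFin s (λ _ → a) ≡ s * a
sumFin-const zero    a = refl
sumFin-const (suc s) a = cong (a +_) (sumFin-const s a)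

lemma4p7 : ∀ {c ℓ} (𝔽 : CommutativeRing c ℓ) → IsField 𝔽
    → (n k s : ℕ) (lam : Fin s → ℕ)
    → (∀ {a b : Fin s} → a F.≤ b → lam b ≤ lam a)
    → sumFin s lam ≡ k → k ≤ n
    → (α : Fin s → ℕ) → sumFin s α ≡ n → (∀ r → lam r ≤ α r)
    → (i j : ℕ) → FreePair s lam α n k i j
    → (t : CommutativeRing.Carrier 𝔽)
    → UnipotentUpperTriangular 𝔽 (k + (n ∸ k) * s)
        (Maps.Umat 𝔽 s (bigΛ n k lam) (k + (n ∸ k) * s) i j t)
      × UnipotentUpperTriangular 𝔽 (k + (n ∸ k) * s)
        (Maps.Uhatmat 𝔽 s (bigΛ n k lam) (k + (n ∸ k) * s) i j t)
-- Only j < i (from the free pair) and Σλ = k are used.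
lemma4p7 𝔽 _ n k s lam _ Σlam≡k _ _ _ _ i j (j<i , _) t =
  matrixOf-unipotent K (Maps.Uimg 𝔽 s Λ i j t) length≡K (Uimg-unipotent t j<i) ,
  matrixOf-unipotent K (Maps.Uhatimg 𝔽 s Λ i j t) length≡K (Uhatimg-unipotent t j<i)
  where
  Λ : Fin s → ℕ
  Λ = bigΛ n k lam
  K : ℕ
  K = k + (n ∸ k) * s
  open Columns 𝔽 s Λ
  length≡K : length (Tableau.cells s Λ) ≡ K
  length≡K = begin
    length (Tableau.cells s Λ)                ≡⟨ ReadingOrder.length-cells s Λ ⟩
    sumFin s (λ r → lam r + (n ∸ k))          ≡⟨ sumFin-+ s lam (λ _ → n ∸ k) ⟩
    sumFin s lam + sumFin s (λ _ → n ∸ k)     ≡⟨ cong₂ _+_ Σlam≡k (sumFin-const s (n ∸ k)) ⟩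
    k + s * (n ∸ k)                           ≡⟨ cong (k +_) (*-comm s (n ∸ k)) ⟩
    K                                         ∎
    where open ≡-Reasoning
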